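{- Let $k\ge2$ and $1\le r\le k$ be integers. For real $P\ge2$ let $\mathscr{S}_r(P)$ be the set of pairs $\mathbf{x},\mathbf{y}\in\mathbb{Z}^r$ with $|\mathbf{x}|\le P$, $|\mathbf{y}|\le P$ and $$|x_1^k-y_1^k|\ge|x_2^k-y_2^k|\ge\dots\ge|x_r^k-y_r^k|\ge1.$$ Then $$\sum_{(\mathbf{x},\mathbf{y})\in\mathscr{S}_r(P)}|x_1^k-y_1^k|^{ -1}\ll P^r\log P,$$ where the implied constant depends only on $k$ and $r$.
   Context: For $\mathbf{x}\in\mathbb{Z}^r$, $|\mathbf{x}|=\max_j|x_j|$. -}

module Defs where

open import Data.Bool using (Bool; true; false; _∧_)
open import Data.Nat as ℕ using (ℕ; zero; suc; _≤ᵇ_)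
open import Data.Integer as ℤ using (ℤ; +_; ∣_∣)
open import Data.List using (List; []; _∷_; [_]; map; concatMap; upTo; filterᵇ; foldr)
open import Data.Vec using (Vec; toList; zipWith)
  renaming ([] to []ᵥ; _∷_ to _∷ᵥ_)
open import Data.Product using (_×_; _,_)
open import Data.Rational as ℚ using (ℚ; 0ℚ)

range : ℕ → List ℤ
range N = map (λ i → (+ i) ℤ.- (+ N)) (upTo (suc (2 ℕ.* N)))

box : ℕ → (r : ℕ) → List (Vec ℤ r)
box N zero = [ []ᵥ ]
box N (suc r) = concatMap (λ a → map (a ∷ᵥ_) (box N r)) (range N)

diffs : (k : ℕ) {r : ℕ} → Vec ℤ r → Vec ℤ r → List ℕ
diffs k x y = toList (zipWith (λ a b → ∣ a ℤ.^ k ℤ.- b ℤ.^ k ∣) x y)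

chainOK : List ℕ → Bool
chainOK [] = true
chainOK (a ∷ []) = 1 ≤ᵇ a
chainOK (a ∷ b ∷ l) = (b ≤ᵇ a) ∧ chainOK (b ∷ l)

-- the set S_r(P) for P with ⌊P⌋ = N, as an explicit (duplicate-free) list
S : (k r N : ℕ) → List (Vec ℤ r × Vec ℤ r)
S k r N = filterᵇ (λ { (x , y) → chainOK (diffs k x y) })
  (concatMap (λ x → map (x ,_) (box N r)) (box N r))

-- 1/n as a rational (with 1/0 := 0, never used on S since entries are ≥ 1)
recip : ℕ → ℚ
recip zero = 0ℚ
recip (suc m) = (+ 1) ℚ./ suc m

firstDiff : List ℕ → ℕ
firstDiff [] = 0
firstDiff (a ∷ _) = a

sumS : (k r N : ℕ) → ℚ
sumS k r N = foldr (λ { (x , y) acc → recip (firstDiff (diffs k x y)) ℚ.+ acc }) 0ℚ (S k r N)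

{-# OPTIONS --safe #-}
module Submission where

-- Write h(a, b) = max(1, |a| ⊔ |b|) for the height and g(a, b) = max(1, ||a| - |b||) for the
-- gap of a pair of integers.  If a^k ≠ b^k then |a^k - b^k| ≥ g h^(k-1).  For (x, y) in
-- S_r(P) let i be a coordinate of largest height; the chain condition and r ≤ k give
--   |x_1^k - y_1^k| ≥ |x_i^k - y_i^k| ≥ g_i h_i^(k-1) ≥ g_i ∏_{j≠i} h_j,
-- hence 1/|x_1^k - y_1^k| ≤ Σ_i 1/(g_i ∏_{j≠i} h_j).  Summed over the whole box this
-- majorant factorises as r A B^(r-1), where A and B are the sums of 1/g and 1/h over
-- |a|, |b| ≤ P.  Each row of 1/g is a harmonic sum, so A ≪ P log P, and B ≪ P because the
-- 2n + 1 pairs (|a|, |b|) with maximum n contribute O(1).  All reciprocals are scaled by N!,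
-- which every height and gap divides, so that the computation takes place in ℕ.

-- An anonymous module keeps the natural-number _/_ used below out of the scope of the
-- final statement, which is about the rational _/_.
module _ where

  open import Data.Bool using (Bool; true; false; T)
  open import Data.Bool.Properties using (T-∧)
  open import Data.Fin using (Fin; zero; suc)
  open import Data.Integer as ℤ using (ℤ; ∣_∣)
  import Data.Integer.Properties as ℤ
  open import Data.List using (List; []; _∷_; _++_; map; concatMap; applyUpTo; upTo; foldr; filterᵇ)
  open import Data.List.Relation.Unary.All as All using (All; []; _∷_)
  import Data.List.Relation.Unary.All.Properties as All
  open import Data.Nat
  open import Data.Nat.Properties
  open import Data.Nat.DivMod using (n/1≡n; m/n*n≤m; m/n*n≡m; /-monoʳ-≤)
  open import Data.Nat.Divisibility using (_∣_; ∣-trans; m∣m*n; m≤n⇒m!∣n!)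
  open import Data.Nat.Induction using (<-rec)
  open import Data.Nat.Logarithm using (⌊log₂_⌋; ⌊log₂⌊n/2⌋⌋≡⌊log₂n⌋∸1; ⌊log₂⌋-mono-≤; ⌊log₂[2*b]⌋≡1+⌊log₂b⌋)
  open import Data.Nat.Solver using (module +-*-Solver)
  open import Data.Product using (_×_; _,_; ∃; proj₁; proj₂; map₂)
  open import Data.Rational as ℚ using (ℚ; 0ℚ; toℚᵘ)
  import Data.Rational.Properties as ℚ
  import Data.Rational.Unnormalised as ℚᵘ
  import Data.Rational.Unnormalised.Properties as ℚᵘ
  open import Data.Sum using (inj₁; inj₂; [_,_]′)
  open import Data.Vec using (Vec; []; _∷_; lookup; toList; zipWith)
  open import Data.Vec.Relation.Binary.Pointwise.Inductive using (Pointwise; []; _∷_)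
  open import Data.Vec.Relation.Unary.All as VecAll using ([]; _∷_)
  open import Function using (_∘_)
  open import Function.Bundles using (Equivalence)
  open import Relation.Binary.PropositionalEquality
  open import Relation.Nullary using (contradiction; yes; no)

  open import Algebra.Properties.CommutativeSemigroup +-commutativeSemigroup
    using () renaming (interchange to +-interchange)
  open import Algebra.Properties.CommutativeSemigroup *-commutativeSemigroup
    using (x∙yz≈y∙xz) renaming (interchange to *-interchange)

  open import Defs

  private variable A B C : Set

  ∑< : ℕ → (ℕ → ℕ) → ℕ
  ∑< zero    f = 0
  ∑< (suc n) f = ∑< n f + f n

  infix 5 ∑<
  syntax ∑< n (λ i → e) = ∑[ i < n ] e

  ∑<-head : ∀ n f → ∑< (suc n) f ≡ f 0 + ∑< n (f ∘ suc)
  ∑<-head zero    f = sym (+-identityʳ (f 0))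
  ∑<-head (suc n) f = begin
    ∑< n f + f n + f (suc n)             ≡⟨ cong (_+ f (suc n)) (∑<-head n f) ⟩
    f 0 + ∑< n (f ∘ suc) + f (suc n)     ≡⟨ +-assoc (f 0) _ _ ⟩
    f 0 + (∑< n (f ∘ suc) + f (suc n))   ∎
    where open ≡-Reasoning

  ∑<-cong : ∀ n {f g} → (∀ i → i < n → f i ≡ g i) → ∑< n f ≡ ∑< n g
  ∑<-cong zero    eq = refl
  ∑<-cong (suc n) eq = cong₂ _+_ (∑<-cong n (λ i i<n → eq i (m<n⇒m<1+n i<n))) (eq n ≤-refl)

  ∑<-bounded : ∀ n {f} c → (∀ i → i < n → f i ≤ c) → ∑< n f ≤ n * c
  ∑<-bounded zero    c le = z≤n
  ∑<-bounded (suc n) c le = ≤-trans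
    (+-mono-≤ (∑<-bounded n c (λ i i<n → le i (m<n⇒m<1+n i<n))) (le n ≤-refl))
    (≤-reflexive (+-comm (n * c) c))

  ∑<-split : ∀ m n f → ∑< (m + n) f ≡ ∑< m f + (∑[ i < n ] f (m + i))
  ∑<-split m zero    f = trans (cong (λ l → ∑< l f) (+-identityʳ m)) (sym (+-identityʳ _))
  ∑<-split m (suc n) f = begin
    ∑< (m + suc n) f                              ≡⟨ cong (λ l → ∑< l f) (+-suc m n) ⟩
    ∑< (m + n) f + f (m + n)                      ≡⟨ cong (_+ f (m + n)) (∑<-split m n f) ⟩
    ∑< m f + (∑[ i < n ] f (m + i)) + f (m + n)   ≡⟨ +-assoc (∑< m f) _ _ ⟩
    ∑< m f + ((∑[ i < n ] f (m + i)) + f (m + n)) ∎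
    where open ≡-Reasoning

  ∑<-reverse : ∀ n f → ∑[ i < n ] f (n ∸ suc i) ≡ ∑< n f
  ∑<-reverse zero    f = refl
  ∑<-reverse (suc n) f = begin
    ∑[ i < suc n ] f (n ∸ i)             ≡⟨ ∑<-head n (λ i → f (n ∸ i)) ⟩
    f n + (∑[ i < n ] f (n ∸ suc i))     ≡⟨ cong (f n +_) (∑<-reverse n f) ⟩
    f n + ∑< n f                         ≡⟨ +-comm (f n) _ ⟩
    ∑< n f + f n                         ∎
    where open ≡-Reasoning

  ∑<-distrib-+ : ∀ n f g → ∑[ i < n ] (f i + g i) ≡ ∑< n f + ∑< n g
  ∑<-distrib-+ zero    f g = refl
  ∑<-distrib-+ (suc n) f g = begin
    (∑[ i < n ] (f i + g i)) + (f n + g n)   ≡⟨ cong (_+ (f n + g n)) (∑<-distrib-+ n f g) ⟩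
    ∑< n f + ∑< n g + (f n + g n)            ≡⟨ +-interchange (∑< n f) _ _ _ ⟩
    ∑< n f + f n + (∑< n g + g n)            ∎
    where open ≡-Reasoning

  ∑<-*ˡ : ∀ n c f → ∑[ i < n ] c * f i ≡ c * ∑< n f
  ∑<-*ˡ zero    c f = sym (*-zeroʳ c)
  ∑<-*ˡ (suc n) c f = trans (cong (_+ c * f n) (∑<-*ˡ n c f)) (sym (*-distribˡ-+ c (∑< n f) (f n)))

  ∑<-mono-length : ∀ {m n} f → m ≤ n → ∑< m f ≤ ∑< n f
  ∑<-mono-length {m} {n} f m≤n = begin
    ∑< m f                                   ≤⟨ m≤m+n _ _ ⟩
    ∑< m f + (∑[ i < n ∸ m ] f (m + i))      ≡⟨ ∑<-split m (n ∸ m) f ⟨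
    ∑< (m + (n ∸ m)) f                       ≡⟨ cong (λ l → ∑< l f) (m+[n∸m]≡n m≤n) ⟩
    ∑< n f                                   ∎
    where open ≤-Reasoning

  ∑∈ : List A → (A → ℕ) → ℕ
  ∑∈ []       f = 0
  ∑∈ (a ∷ as) f = f a + ∑∈ as f

  infix 5 ∑∈
  syntax ∑∈ xs (λ x → e) = ∑[ x ∈ xs ] e

  ∑∈-++ : ∀ (xs ys : List A) f → ∑∈ (xs ++ ys) f ≡ ∑∈ xs f + ∑∈ ys f
  ∑∈-++ []       ys f = refl
  ∑∈-++ (x ∷ xs) ys f = trans (cong (f x +_) (∑∈-++ xs ys f)) (sym (+-assoc (f x) _ _))

  ∑∈-mono-≤ : ∀ (xs : List A) {f g} → (∀ a → f a ≤ g a) → ∑∈ xs f ≤ ∑∈ xs g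
  ∑∈-mono-≤ []       le = z≤n
  ∑∈-mono-≤ (x ∷ xs) le = +-mono-≤ (le x) (∑∈-mono-≤ xs le)

  ∑∈-cong : ∀ (xs : List A) {f g} → (∀ a → f a ≡ g a) → ∑∈ xs f ≡ ∑∈ xs g
  ∑∈-cong []       eq = refl
  ∑∈-cong (x ∷ xs) eq = cong₂ _+_ (eq x) (∑∈-cong xs eq)

  ∑∈-*ˡ : ∀ (xs : List A) c f → ∑[ a ∈ xs ] c * f a ≡ c * ∑∈ xs f
  ∑∈-*ˡ []       c f = sym (*-zeroʳ c)
  ∑∈-*ˡ (x ∷ xs) c f = trans (cong (c * f x +_) (∑∈-*ˡ xs c f)) (sym (*-distribˡ-+ c (f x) _))

  ∑∈-*ʳ : ∀ (xs : List A) c f → ∑[ a ∈ xs ] f a * c ≡ ∑∈ xs f * c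
  ∑∈-*ʳ []       c f = refl
  ∑∈-*ʳ (x ∷ xs) c f = trans (cong (f x * c +_) (∑∈-*ʳ xs c f)) (sym (*-distribʳ-+ c (f x) _))

  ∑∈-distrib-+ : ∀ (xs : List A) f g → ∑[ a ∈ xs ] (f a + g a) ≡ ∑∈ xs f + ∑∈ xs g
  ∑∈-distrib-+ []       f g = refl
  ∑∈-distrib-+ (x ∷ xs) f g =
    trans (cong (f x + g x +_) (∑∈-distrib-+ xs f g)) (+-interchange (f x) (g x) _ _)

  ∑∈-map : ∀ (g : A → B) xs f → ∑∈ (map g xs) f ≡ ∑∈ xs (f ∘ g)
  ∑∈-map g []       f = refl
  ∑∈-map g (x ∷ xs) f = cong (f (g x) +_) (∑∈-map g xs f)

  ∑∈-concatMap : ∀ (g : A → List B) xs f →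
                 ∑∈ (concatMap g xs) f ≡ ∑[ a ∈ xs ] ∑∈ (g a) f
  ∑∈-concatMap g []       f = refl
  ∑∈-concatMap g (x ∷ xs) f =
    trans (∑∈-++ (g x) (concatMap g xs) f) (cong (∑∈ (g x) f +_) (∑∈-concatMap g xs f))

  ∑∈-applyUpTo : ∀ (h : ℕ → A) n f → ∑∈ (applyUpTo h n) f ≡ ∑< n (f ∘ h)
  ∑∈-applyUpTo h zero    f = refl
  ∑∈-applyUpTo h (suc n) f =
    trans (cong (f (h 0) +_) (∑∈-applyUpTo (h ∘ suc) n f)) (sym (∑<-head n (f ∘ h)))

  ∑∈-zero : ∀ (xs : List A) → ∑[ x ∈ xs ] 0 ≡ 0
  ∑∈-zero []       = refl
  ∑∈-zero (_ ∷ xs) = ∑∈-zero xs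

  ∑∈-comm : ∀ (xs : List A) (ys : List B) (f : A → B → ℕ) →
            ∑[ x ∈ xs ] ∑[ y ∈ ys ] f x y ≡ ∑[ y ∈ ys ] ∑[ x ∈ xs ] f x y
  ∑∈-comm []       ys f = sym (∑∈-zero ys)
  ∑∈-comm (x ∷ xs) ys f = trans (cong (∑∈ ys (f x) +_) (∑∈-comm xs ys f))
                                (sym (∑∈-distrib-+ ys (f x) (λ y → ∑[ x ∈ xs ] f x y)))

  ∑² : List A → (A → A → ℕ) → ℕ
  ∑² xs G = ∑[ x ∈ xs ] ∑[ y ∈ xs ] G x y

  ∑²-cong : ∀ (xs : List A) {G H} → (∀ x y → G x y ≡ H x y) → ∑² xs G ≡ ∑² xs H
  ∑²-cong xs eq = ∑∈-cong xs (λ x → ∑∈-cong xs (eq x))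

  ∑²-distrib-+ : ∀ (xs : List A) (G H : A → A → ℕ) → ∑² xs (λ x y → G x y + H x y) ≡ ∑² xs G + ∑² xs H
  ∑²-distrib-+ xs G H = trans (∑∈-cong xs (λ x → ∑∈-distrib-+ xs (G x) (H x)))
                              (∑∈-distrib-+ xs (λ x → ∑∈ xs (G x)) (λ x → ∑∈ xs (H x)))

  ∑²-*ˡ : ∀ (xs : List A) c (G : A → A → ℕ) → ∑² xs (λ x y → c * G x y) ≡ c * ∑² xs G
  ∑²-*ˡ xs c G = trans (∑∈-cong xs (λ x → ∑∈-*ˡ xs c (G x))) (∑∈-*ˡ xs c (λ x → ∑∈ xs (G x)))

  ∑²-*ʳ : ∀ (xs : List A) c (G : A → A → ℕ) → ∑² xs (λ x y → G x y * c) ≡ ∑² xs G * c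
  ∑²-*ʳ xs c G = trans (∑∈-cong xs (λ x → ∑∈-*ʳ xs c (G x))) (∑∈-*ʳ xs c (λ x → ∑∈ xs (G x)))

  ∑²-product : ∀ (xs : List A) (ys : List B) (g : A → A → ℕ) (h : B → B → ℕ) →
               ∑² xs (λ a b → ∑² ys (λ x y → g a b * h x y)) ≡ ∑² xs g * ∑² ys h
  ∑²-product xs ys g h =
    trans (∑²-cong xs (λ a b → ∑²-*ˡ ys (g a b) h)) (∑²-*ʳ xs (∑² ys h) g)

  ∑∈-pairs : ∀ (xs : List A) (G : A → A → ℕ) →
    ∑∈ (concatMap (λ x → map (x ,_) xs) xs) (λ e → G (proj₁ e) (proj₂ e)) ≡ ∑² xs G
  ∑∈-pairs xs G = trans (∑∈-concatMap (λ x → map (x ,_) xs) xs _) (∑∈-cong xs (λ x → ∑∈-map (x ,_) xs _))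

  ⌈n/2⌉≤1+⌊n/2⌋ : ∀ n → ⌈ n /2⌉ ≤ suc ⌊ n /2⌋
  ⌈n/2⌉≤1+⌊n/2⌋ zero          = z≤n
  ⌈n/2⌉≤1+⌊n/2⌋ (suc zero)    = s≤s z≤n
  ⌈n/2⌉≤1+⌊n/2⌋ (suc (suc n)) = s≤s (⌈n/2⌉≤1+⌊n/2⌋ n)

  2≤n⇒1≤⌊log₂n⌋ : ∀ {n} → 2 ≤ n → 1 ≤ ⌊log₂ n ⌋
  2≤n⇒1≤⌊log₂n⌋ = ⌊log₂⌋-mono-≤ {2}

  ⌊log₂2+n⌋≡1+⌊log₂⌊2+n/2⌋⌋ : ∀ n → ⌊log₂ (2 + n) ⌋ ≡ suc ⌊log₂ ⌊ 2 + n /2⌋ ⌋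
  ⌊log₂2+n⌋≡1+⌊log₂⌊2+n/2⌋⌋ n = begin
    ⌊log₂ (2 + n) ⌋               ≡⟨ m∸n+n≡m (2≤n⇒1≤⌊log₂n⌋ {2 + n} (s≤s (s≤s z≤n))) ⟨
    ⌊log₂ (2 + n) ⌋ ∸ 1 + 1       ≡⟨ +-comm _ 1 ⟩
    suc (⌊log₂ (2 + n) ⌋ ∸ 1)     ≡⟨ cong suc (⌊log₂⌊n/2⌋⌋≡⌊log₂n⌋∸1 (2 + n)) ⟨
    suc ⌊log₂ ⌊ 2 + n /2⌋ ⌋       ∎
    where open ≡-Reasoning

  1+n≤2*n : ∀ {n} → 1 ≤ n → suc n ≤ 2 * n
  1+n≤2*n {n} 1≤n = subst (suc n ≤_) (cong (n +_) (sym (+-identityʳ n))) (+-monoˡ-≤ n 1≤n)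

  ⌊log₂[2+n]⌋≤1+⌊log₂[1+n]⌋ : ∀ n → ⌊log₂ (2 + n) ⌋ ≤ suc ⌊log₂ (suc n) ⌋
  ⌊log₂[2+n]⌋≤1+⌊log₂[1+n]⌋ n = begin
    ⌊log₂ (2 + n) ⌋           ≤⟨ ⌊log₂⌋-mono-≤ (1+n≤2*n {suc n} (s≤s z≤n)) ⟩
    ⌊log₂ (2 * suc n) ⌋       ≡⟨ ⌊log₂[2*b]⌋≡1+⌊log₂b⌋ (suc n) ⟩
    suc ⌊log₂ (suc n) ⌋       ∎
    where open ≤-Reasoning

  harmonic≤ : ∀ F n → ∑[ s < n ] F / suc s ≤ F * suc ⌊log₂ n ⌋
  harmonic≤ F = <-rec _ bound
    where
    open ≤-Reasoning
    bound : ∀ n → (∀ {m} → m < n → ∑[ s < m ] F / suc s ≤ F * suc ⌊log₂ m ⌋) →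
            ∑[ s < n ] F / suc s ≤ F * suc ⌊log₂ n ⌋
    bound zero          _   = z≤n
    bound (suc zero)    _   = begin
      F / 1       ≡⟨ n/1≡n F ⟩
      F           ≡⟨ *-identityʳ F ⟨
      F * 1       ∎
    bound n@(suc (suc m)) rec = begin
      ∑[ s < n ] F / suc s                                  ≡⟨ cong (λ l → ∑[ s < l ] F / suc s) (⌊n/2⌋+⌈n/2⌉≡n n) ⟨
      ∑[ s < h + c ] F / suc s                              ≡⟨ ∑<-split h c _ ⟩
      (∑[ s < h ] F / suc s) + (∑[ i < c ] F / suc (h + i)) ≤⟨ +-mono-≤ (rec (⌊n/2⌋<n (suc m))) upper-half ⟩
      F * suc ⌊log₂ h ⌋ + F                                 ≡⟨ +-comm _ F ⟩
      F + F * suc ⌊log₂ h ⌋                                 ≡⟨ *-suc F _ ⟨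
      F * suc (suc ⌊log₂ h ⌋)                               ≡⟨ cong (λ l → F * suc l) (⌊log₂2+n⌋≡1+⌊log₂⌊2+n/2⌋⌋ m) ⟨
      F * suc ⌊log₂ n ⌋                                     ∎
      where
      h = ⌊ n /2⌋
      c = ⌈ n /2⌉
      upper-half : ∑[ i < c ] F / suc (h + i) ≤ F
      upper-half = begin
        ∑[ i < c ] F / suc (h + i)   ≤⟨ ∑<-bounded c (F / suc h) (λ i _ → /-monoʳ-≤ F (s≤s (m≤m+n h i))) ⟩
        c * (F / suc h)              ≤⟨ *-monoˡ-≤ (F / suc h) (⌈n/2⌉≤1+⌊n/2⌋ n) ⟩
        suc h * (F / suc h)          ≡⟨ *-comm (suc h) (F / suc h) ⟩
        F / suc h * suc h            ≤⟨ m/n*n≤m F (suc h) ⟩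
        F                            ∎

  -- n ⊔ 1, written so that it is syntactically nonzero and can be a divisor
  max1 : ℕ → ℕ
  max1 n = suc (n ∸ 1)

  gap height : ℕ → ℕ → ℕ
  gap    α β = max1 ∣ α - β ∣
  height α β = max1 (α ⊔ β)

  1≤n⇒max1n≡n : ∀ {n} → 1 ≤ n → max1 n ≡ n
  1≤n⇒max1n≡n {suc n} _ = refl

  max1≤ : ∀ {m n} → 1 ≤ n → m ≤ n → max1 m ≤ n
  max1≤ {zero}  1≤n _   = 1≤n
  max1≤ {suc m} _   m≤n = m≤n

  ∑<²-suc : ∀ n (K : ℕ → ℕ → ℕ) →
    ∑[ α < suc n ] ∑[ β < suc n ] K α β ≡
    (∑[ α < n ] ∑[ β < n ] K α β) + (∑[ α < n ] K α n) + (∑[ β < suc n ] K n β)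
  ∑<²-suc n K = cong (_+ ∑< (suc n) (K n)) (∑<-distrib-+ n (λ α → ∑< n (K α)) (λ α → K α n))

  ∑-gap-column : ∀ F n → ∑[ α < n ] F / gap α n ≡ ∑[ s < n ] F / suc s
  ∑-gap-column F n = trans
    (∑<-cong n (λ α α<n → cong (λ d → F / max1 d) (trans (m≤n⇒∣m-n∣≡n∸m (<⇒≤ α<n)) (+-∸-assoc 1 α<n))))
    (∑<-reverse n (λ s → F / suc s))

  ∑-gap-row : ∀ F n → ∑[ β < suc n ] F / gap n β ≡ (∑[ s < n ] F / suc s) + F
  ∑-gap-row F n = cong₂ _+_
    (trans (∑<-cong n (λ β _ → cong (λ d → F / max1 d) (∣-∣-comm n β))) (∑-gap-column F n))
    (trans (cong (λ d → F / max1 d) (∣n-n∣≡0 n)) (n/1≡n F))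

  ∑<²-F/gap≤ : ∀ F n → ∑[ α < n ] ∑[ β < n ] F / gap α β ≤ n * (2 * (∑[ s < n ] F / suc s) + F)
  ∑<²-F/gap≤ F zero    = z≤n
  ∑<²-F/gap≤ F (suc n) = begin
    ∑[ α < suc n ] ∑[ β < suc n ] F / gap α β
      ≡⟨ ∑<²-suc n (λ α β → F / gap α β) ⟩
    G n + (∑[ α < n ] F / gap α n) + (∑[ β < suc n ] F / gap n β)
      ≡⟨ cong₂ (λ c r → G n + c + r) (∑-gap-column F n) (∑-gap-row F n) ⟩
    G n + H n + (H n + F)
      ≤⟨ +-monoˡ-≤ (H n + F) (+-monoˡ-≤ (H n) (∑<²-F/gap≤ F n)) ⟩
    n * (2 * H n + F) + H n + (H n + F)
      ≡⟨ solve 3 (λ n h F → n :* (con 2 :* h :+ F) :+ h :+ (h :+ F) := (con 1 :+ n) :* (con 2 :* h :+ F)) refl n (H n) F ⟩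
    suc n * (2 * H n + F)
      ≤⟨ *-monoʳ-≤ (suc n) (+-monoˡ-≤ F (*-monoʳ-≤ 2 (∑<-mono-length _ (n≤1+n n)))) ⟩
    suc n * (2 * H (suc n) + F)
      ∎
    where
    open ≤-Reasoning
    open +-*-Solver
    G H : ℕ → ℕ
    G m = ∑[ α < m ] ∑[ β < m ] F / gap α β
    H m = ∑[ s < m ] F / suc s

  n+1+n≤3*max1n : ∀ n → n + suc n ≤ 3 * max1 n
  n+1+n≤3*max1n zero    = s≤s z≤n
  n+1+n≤3*max1n (suc n) = begin
    suc n + suc (suc n)        ≤⟨ +-monoʳ-≤ (suc n) (s≤s (s≤s (m≤m+n n n))) ⟩
    suc n + suc (suc (n + n))  ≡⟨ solve 1 (λ n → (con 1 :+ n) :+ (con 2 :+ (n :+ n)) := con 3 :* (con 1 :+ n)) refl n ⟩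
    3 * suc n                  ∎
    where
    open ≤-Reasoning
    open +-*-Solver

  [n+1+n]*[F/max1n]≤3F : ∀ F n → (n + suc n) * (F / max1 n) ≤ 3 * F
  [n+1+n]*[F/max1n]≤3F F n = begin
    (n + suc n) * q       ≤⟨ *-monoˡ-≤ q (n+1+n≤3*max1n n) ⟩
    3 * max1 n * q        ≡⟨ *-assoc 3 (max1 n) q ⟩
    3 * (max1 n * q)      ≡⟨ cong (3 *_) (*-comm (max1 n) q) ⟩
    3 * (q * max1 n)      ≤⟨ *-monoʳ-≤ 3 (m/n*n≤m F (max1 n)) ⟩
    3 * F                 ∎
    where
    open ≤-Reasoning
    q = F / max1 n

  ∑<²-F/height≤ : ∀ F n → ∑[ α < n ] ∑[ β < n ] F / height α β ≤ n * (3 * F)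
  ∑<²-F/height≤ F zero    = z≤n
  ∑<²-F/height≤ F (suc n) = begin
    ∑[ α < suc n ] ∑[ β < suc n ] F / height α β
      ≡⟨ ∑<²-suc n (λ α β → F / height α β) ⟩
    G n + (∑[ α < n ] F / height α n) + (∑[ β < suc n ] F / height n β)
      ≤⟨ +-mono-≤ (+-mono-≤ (∑<²-F/height≤ F n) (∑<-bounded n q column)) (∑<-bounded (suc n) q row) ⟩
    n * (3 * F) + n * q + suc n * q
      ≡⟨ +-assoc (n * (3 * F)) _ _ ⟩
    n * (3 * F) + (n * q + suc n * q)
      ≡⟨ cong (n * (3 * F) +_) (*-distribʳ-+ q n (suc n)) ⟨
    n * (3 * F) + (n + suc n) * q
      ≤⟨ +-monoʳ-≤ (n * (3 * F)) ([n+1+n]*[F/max1n]≤3F F n) ⟩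
    n * (3 * F) + 3 * F
      ≡⟨ +-comm (n * (3 * F)) _ ⟩
    suc n * (3 * F)
      ∎
    where
    open ≤-Reasoning
    G : ℕ → ℕ
    G m = ∑[ α < m ] ∑[ β < m ] F / height α β
    q = F / max1 n
    column : ∀ α → α < n → F / height α n ≤ q
    column α α<n = ≤-reflexive (cong (λ d → F / max1 d) (m≤n⇒m⊔n≡n (<⇒≤ α<n)))
    row : ∀ β → β < suc n → F / height n β ≤ q
    row β β≤n = ≤-reflexive (cong (λ d → F / max1 d) (m≥n⇒m⊔n≡m (≤-pred β≤n)))

  ∣[+m]-[+n]∣≡∣m-n∣ : ∀ m n → ∣ ℤ.+ m ℤ.- ℤ.+ n ∣ ≡ ∣ m - n ∣
  ∣[+m]-[+n]∣≡∣m-n∣ m n with ≤-total m n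
  ... | inj₁ m≤n = begin
    ∣ ℤ.+ m ℤ.- ℤ.+ n ∣   ≡⟨ cong ∣_∣ (ℤ.[+m]-[+n]≡m⊖n m n) ⟩
    ∣ m ℤ.⊖ n ∣       ≡⟨ ℤ.∣⊖∣-≤ m≤n ⟩
    n ∸ m             ≡⟨ m≤n⇒∣m-n∣≡n∸m m≤n ⟨
    ∣ m - n ∣         ∎
    where open ≡-Reasoning
  ... | inj₂ n≤m = begin
    ∣ ℤ.+ m ℤ.- ℤ.+ n ∣   ≡⟨ cong ∣_∣ (ℤ.[+m]-[+n]≡m⊖n m n) ⟩
    ∣ m ℤ.⊖ n ∣       ≡⟨ ℤ.∣m⊖n∣≡∣n⊖m∣ m n ⟩
    ∣ n ℤ.⊖ m ∣       ≡⟨ ℤ.∣⊖∣-≤ n≤m ⟩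
    m ∸ n             ≡⟨ m≤n⇒∣n-m∣≡n∸m n≤m ⟨
    ∣ m - n ∣         ∎
    where open ≡-Reasoning

  ∣m-n∣≤n : ∀ {m n} → m ≤ 2 * n → ∣ m - n ∣ ≤ n
  ∣m-n∣≤n {m} {n} m≤2n with ∣m-n∣≡[m∸n]∨[n∸m] m n
  ... | inj₁ eq = subst (_≤ n) (sym eq) (m≤n+o⇒m∸n≤o m n (subst (m ≤_) (cong (n +_) (+-identityʳ n)) m≤2n))
  ... | inj₂ eq = subst (_≤ n) (sym eq) (m∸n≤m n m)

  ∑-range≤ : ∀ N (g : ℕ → ℕ) → ∑[ b ∈ range N ] g ∣ b ∣ ≤ 2 * ∑< (suc N) g
  ∑-range≤ N g = begin
    ∑[ b ∈ range N ] g ∣ b ∣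
      ≡⟨ ∑∈-map _ (upTo (suc (2 * N))) (λ b → g ∣ b ∣) ⟩
    ∑[ i ∈ upTo (suc (2 * N)) ] g ∣ ℤ.+ i ℤ.- ℤ.+ N ∣
      ≡⟨ ∑∈-applyUpTo (λ i → i) (suc (2 * N)) _ ⟩
    ∑[ i < suc (2 * N) ] g ∣ ℤ.+ i ℤ.- ℤ.+ N ∣
      ≡⟨ ∑<-cong (suc (2 * N)) (λ i _ → cong g (∣[+m]-[+n]∣≡∣m-n∣ i N)) ⟩
    ∑[ i < suc (2 * N) ] g ∣ i - N ∣
      ≡⟨ cong (λ l → ∑[ i < l ] g ∣ i - N ∣) (solve 1 (λ N → con 1 :+ con 2 :* N := N :+ (con 1 :+ N)) refl N) ⟩
    ∑[ i < N + suc N ] g ∣ i - N ∣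
      ≡⟨ ∑<-split N (suc N) _ ⟩
    (∑[ i < N ] g ∣ i - N ∣) + (∑[ j < suc N ] g ∣ N + j - N ∣)
      ≡⟨ cong₂ _+_ below above ⟩
    ∑< N (g ∘ suc) + ∑< (suc N) g
      ≤⟨ +-monoˡ-≤ (∑< (suc N) g) (≤-trans (m≤n+m _ (g 0)) (≤-reflexive (sym (∑<-head N g)))) ⟩
    ∑< (suc N) g + ∑< (suc N) g
      ≡⟨ cong (∑< (suc N) g +_) (+-identityʳ _) ⟨
    2 * ∑< (suc N) g
      ∎
    where
    open ≤-Reasoning
    open +-*-Solver
    below : ∑[ i < N ] g ∣ i - N ∣ ≡ ∑< N (g ∘ suc)
    below = trans (∑<-cong N (λ i i<N → cong g (trans (m≤n⇒∣m-n∣≡n∸m (<⇒≤ i<N)) (+-∸-assoc 1 i<N))))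
                  (∑<-reverse N (g ∘ suc))
    above : ∑[ j < suc N ] g ∣ N + j - N ∣ ≡ ∑< (suc N) g
    above = ∑<-cong (suc N) (λ j _ → cong g (trans (∣-∣-comm (N + j) N) (∣m-m+n∣≡n N j)))

  ∑²-range≤ : ∀ N (K : ℕ → ℕ → ℕ) →
    ∑² (range N) (λ a b → K ∣ a ∣ ∣ b ∣) ≤ 2 * (2 * (∑[ α < suc N ] ∑[ β < suc N ] K α β))
  ∑²-range≤ N K = begin
    ∑² (range N) (λ a b → K ∣ a ∣ ∣ b ∣)            ≤⟨ ∑∈-mono-≤ (range N) (λ a → ∑-range≤ N (K ∣ a ∣)) ⟩
    ∑[ a ∈ range N ] 2 * ∑< (suc N) (K ∣ a ∣)       ≤⟨ ∑-range≤ N (λ α → 2 * ∑< (suc N) (K α)) ⟩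
    2 * (∑[ α < suc N ] 2 * ∑< (suc N) (K α))       ≡⟨ cong (2 *_) (∑<-*ˡ (suc N) 2 _) ⟩
    2 * (2 * (∑[ α < suc N ] ∑[ β < suc N ] K α β)) ∎
    where open ≤-Reasoning

  ∑-box-suc : ∀ N r (h : Vec ℤ (suc r) → ℕ) →
              ∑∈ (box N (suc r)) h ≡ ∑[ a ∈ range N ] ∑[ x ∈ box N r ] h (a ∷ x)
  ∑-box-suc N r h = trans (∑∈-concatMap (λ a → map (a ∷_) (box N r)) (range N) h)
                          (∑∈-cong (range N) (λ a → ∑∈-map (a ∷_) (box N r) h))

  ∑²-box-suc : ∀ N r (G : Vec ℤ (suc r) → Vec ℤ (suc r) → ℕ) →
    ∑² (box N (suc r)) G ≡ ∑² (range N) (λ a b → ∑² (box N r) (λ x y → G (a ∷ x) (b ∷ y)))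
  ∑²-box-suc N r G = begin
    ∑² (box N (suc r)) G
      ≡⟨ ∑-box-suc N r (λ u → ∑∈ (box N (suc r)) (G u)) ⟩
    ∑[ a ∈ range N ] ∑[ x ∈ box N r ] ∑[ v ∈ box N (suc r) ] G (a ∷ x) v
      ≡⟨ ∑∈-cong (range N) (λ a → ∑∈-cong (box N r) (λ x → ∑-box-suc N r (G (a ∷ x)))) ⟩
    ∑[ a ∈ range N ] ∑[ x ∈ box N r ] ∑[ b ∈ range N ] ∑[ y ∈ box N r ] G (a ∷ x) (b ∷ y)
      ≡⟨ ∑∈-cong (range N) (λ a → ∑∈-comm (box N r) (range N) _) ⟩
    ∑[ a ∈ range N ] ∑[ b ∈ range N ] ∑[ x ∈ box N r ] ∑[ y ∈ box N r ] G (a ∷ x) (b ∷ y)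
      ∎
    where open ≡-Reasoning

  Bounded : ℕ → ∀ {n} → Vec ℤ n → Set
  Bounded N = VecAll.All (λ a → ∣ a ∣ ≤ N)

  range-bounded : ∀ N → All (λ a → ∣ a ∣ ≤ N) (range N)
  range-bounded N = All.map⁺ (All.applyUpTo⁺₁ (λ i → i) (suc (2 * N))
    (λ {i} i<1+2N → subst (_≤ N) (sym (∣[+m]-[+n]∣≡∣m-n∣ i N)) (∣m-n∣≤n (≤-pred i<1+2N))))

  box-bounded : ∀ N r → All (Bounded N) (box N r)
  box-bounded N zero    = [] ∷ []
  box-bounded N (suc r) =
    All.concat⁺ (All.map⁺ (All.map (λ ∣a∣≤N → All.map⁺ (All.map (∣a∣≤N ∷_) (box-bounded N r))) (range-bounded N)))

  pairs-bounded : ∀ N r →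
    All (λ e → Bounded N (proj₁ e) × Bounded N (proj₂ e)) (concatMap (λ x → map (x ,_) (box N r)) (box N r))
  pairs-bounded N r =
    All.concat⁺ (All.map⁺ (All.map (λ bx → All.map⁺ (All.map (bx ,_) (box-bounded N r))) (box-bounded N r)))

  ∣i^n∣≡∣i∣^n : ∀ i n → ∣ i ℤ.^ n ∣ ≡ ∣ i ∣ ^ n
  ∣i^n∣≡∣i∣^n i zero    = refl
  ∣i^n∣≡∣i∣^n i (suc n) = trans (ℤ.∣i*j∣≡∣i∣*∣j∣ i (i ℤ.^ n)) (cong (∣ i ∣ *_) (∣i^n∣≡∣i∣^n i n))

  ∣i∣∸∣j∣≤∣i-j∣ : ∀ i j → ∣ i ∣ ∸ ∣ j ∣ ≤ ∣ i ℤ.- j ∣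
  ∣i∣∸∣j∣≤∣i-j∣ i j = m≤n+o⇒m∸n≤o ∣ i ∣ ∣ j ∣ (begin
    ∣ i ∣                      ≡⟨ cong ∣_∣ i-j+j≡i ⟨
    ∣ i ℤ.- j ℤ.+ j ∣          ≤⟨ ℤ.∣i+j∣≤∣i∣+∣j∣ (i ℤ.- j) j ⟩
    ∣ i ℤ.- j ∣ + ∣ j ∣        ≡⟨ +-comm ∣ i ℤ.- j ∣ ∣ j ∣ ⟩
    ∣ j ∣ + ∣ i ℤ.- j ∣        ∎)
    where
    open ≤-Reasoning
    i-j+j≡i : i ℤ.- j ℤ.+ j ≡ i
    i-j+j≡i = trans (ℤ.+-assoc i (ℤ.- j) j) (trans (cong (λ k → i ℤ.+ k) (ℤ.+-inverseˡ j)) (ℤ.+-identityʳ i))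

  ∣∣i∣-∣j∣∣≤∣i-j∣ : ∀ i j → ∣ ∣ i ∣ - ∣ j ∣ ∣ ≤ ∣ i ℤ.- j ∣
  ∣∣i∣-∣j∣∣≤∣i-j∣ i j with ∣m-n∣≡[m∸n]∨[n∸m] ∣ i ∣ ∣ j ∣
  ... | inj₁ eq = subst (_≤ ∣ i ℤ.- j ∣) (sym eq) (∣i∣∸∣j∣≤∣i-j∣ i j)
  ... | inj₂ eq = subst₂ _≤_ (sym eq) (ℤ.∣i-j∣≡∣j-i∣ j i) (∣i∣∸∣j∣≤∣i-j∣ j i)

  ∣i∣≡∣j∣∧i≢j⇒∣i∣≤∣i-j∣ : ∀ {i j} → ∣ i ∣ ≡ ∣ j ∣ → i ≢ j → ∣ i ∣ ≤ ∣ i ℤ.- j ∣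
  ∣i∣≡∣j∣∧i≢j⇒∣i∣≤∣i-j∣ {ℤ.+ m}      {ℤ.+ n}      refl i≢j = contradiction refl i≢j
  ∣i∣≡∣j∣∧i≢j⇒∣i∣≤∣i-j∣ {ℤ.+ m}      {ℤ.-[1+ n ]} _    _   = m≤m+n m (suc n)
  ∣i∣≡∣j∣∧i≢j⇒∣i∣≤∣i-j∣ {ℤ.-[1+ m ]} {ℤ.+ suc n}  _    _   = s≤s (m≤n⇒m≤1+n (m≤m+n m n))
  ∣i∣≡∣j∣∧i≢j⇒∣i∣≤∣i-j∣ {ℤ.-[1+ m ]} {ℤ.-[1+ n ]} refl i≢j = contradiction refl i≢j

  ∣α-β∣*[α⊔β]^k≤∣α^[1+k]-β^[1+k]∣ : ∀ α β k → ∣ α - β ∣ * (α ⊔ β) ^ k ≤ ∣ α ^ suc k - β ^ suc k ∣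
  ∣α-β∣*[α⊔β]^k≤∣α^[1+k]-β^[1+k]∣ α β k = [ ordered , swapped ]′ (≤-total β α)
    where
    open ≤-Reasoning
    ordered : ∀ {α β} → β ≤ α → ∣ α - β ∣ * (α ⊔ β) ^ k ≤ ∣ α ^ suc k - β ^ suc k ∣
    ordered {α} {β} β≤α = begin
      ∣ α - β ∣ * (α ⊔ β) ^ k      ≡⟨ cong₂ (λ d m → d * m ^ k) (m≤n⇒∣n-m∣≡n∸m β≤α) (m≥n⇒m⊔n≡m β≤α) ⟩
      (α ∸ β) * α ^ k              ≡⟨ *-distribʳ-∸ (α ^ k) α β ⟩
      α * α ^ k ∸ β * α ^ k        ≤⟨ ∸-monoʳ-≤ (α * α ^ k) (*-monoʳ-≤ β (^-monoˡ-≤ k β≤α)) ⟩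
      α ^ suc k ∸ β ^ suc k        ≤⟨ m∸n≤∣m-n∣ (α ^ suc k) (β ^ suc k) ⟩
      ∣ α ^ suc k - β ^ suc k ∣    ∎
    swapped : α ≤ β → ∣ α - β ∣ * (α ⊔ β) ^ k ≤ ∣ α ^ suc k - β ^ suc k ∣
    swapped α≤β = subst₂ (λ d m → d * m ^ k ≤ ∣ α ^ suc k - β ^ suc k ∣) (∣-∣-comm β α) (⊔-comm β α)
      (subst (∣ β - α ∣ * (β ⊔ α) ^ k ≤_) (∣-∣-comm (β ^ suc k) (α ^ suc k)) (ordered α≤β))

  max1[α]^k≤d : ∀ α k {d} → 1 ≤ d → α ^ suc k ≤ d → max1 α ^ k ≤ d
  max1[α]^k≤d zero      k 1≤d _   = subst (_≤ _) (sym (^-zeroˡ k)) 1≤d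
  max1[α]^k≤d (suc α)   k _   α^[1+k]≤d = ≤-trans (m≤n*m (suc α ^ k) (suc α)) α^[1+k]≤d

  1≤∣i-j∣⇒i≢j : ∀ {i j} → 1 ≤ ∣ i ℤ.- j ∣ → i ≢ j
  1≤∣i-j∣⇒i≢j {i} 1≤∣i-i∣ refl = <⇒≱ 1≤∣i-i∣ (≤-reflexive (cong ∣_∣ (ℤ.+-inverseʳ i)))

  gapℤ heightℤ : ℤ → ℤ → ℕ
  gapℤ    a b = gap ∣ a ∣ ∣ b ∣
  heightℤ a b = height ∣ a ∣ ∣ b ∣

  gap*height^k≤∣a^[1+k]-b^[1+k]∣ : ∀ k a b → 1 ≤ ∣ a ℤ.^ suc k ℤ.- b ℤ.^ suc k ∣ →
    gapℤ a b * heightℤ a b ^ k ≤ ∣ a ℤ.^ suc k ℤ.- b ℤ.^ suc k ∣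
  gap*height^k≤∣a^[1+k]-b^[1+k]∣ k a b 1≤d with ∣ a ∣ ≟ ∣ b ∣
  ... | no α≢β = begin
    gap α β * height α β ^ k                ≡⟨ cong₂ (λ g h → g * h ^ k) (1≤n⇒max1n≡n 1≤∣α-β∣) (1≤n⇒max1n≡n 1≤α⊔β) ⟩
    ∣ α - β ∣ * (α ⊔ β) ^ k                 ≤⟨ ∣α-β∣*[α⊔β]^k≤∣α^[1+k]-β^[1+k]∣ α β k ⟩
    ∣ α ^ suc k - β ^ suc k ∣               ≡⟨ cong₂ ∣_-_∣ (∣i^n∣≡∣i∣^n a (suc k)) (∣i^n∣≡∣i∣^n b (suc k)) ⟨
    ∣ ∣ a ℤ.^ suc k ∣ - ∣ b ℤ.^ suc k ∣ ∣   ≤⟨ ∣∣i∣-∣j∣∣≤∣i-j∣ (a ℤ.^ suc k) (b ℤ.^ suc k) ⟩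
    ∣ a ℤ.^ suc k ℤ.- b ℤ.^ suc k ∣         ∎
    where
    open ≤-Reasoning
    α = ∣ a ∣
    β = ∣ b ∣
    1≤∣α-β∣ : 1 ≤ ∣ α - β ∣
    1≤∣α-β∣ = n≢0⇒n>0 (α≢β ∘ ∣m-n∣≡0⇒m≡n)
    1≤α⊔β : 1 ≤ α ⊔ β
    1≤α⊔β = ≤-trans 1≤∣α-β∣ (∣m-n∣≤m⊔n α β)
  ... | yes α≡β = begin
    gap α β * height α β ^ k                ≡⟨ cong (λ g → max1 g * height α β ^ k) (m≡n⇒∣m-n∣≡0 α≡β) ⟩
    1 * height α β ^ k                      ≡⟨ *-identityˡ _ ⟩
    max1 (α ⊔ β) ^ k                        ≡⟨ cong (λ m → max1 m ^ k) (trans (cong (α ⊔_) (sym α≡β)) (⊔-idem α)) ⟩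
    max1 α ^ k                              ≤⟨ max1[α]^k≤d α k 1≤d α^[1+k]≤d ⟩
    ∣ a ℤ.^ suc k ℤ.- b ℤ.^ suc k ∣         ∎
    where
    open ≤-Reasoning
    α = ∣ a ∣
    β = ∣ b ∣
    ∣a^[1+k]∣≡∣b^[1+k]∣ : ∣ a ℤ.^ suc k ∣ ≡ ∣ b ℤ.^ suc k ∣
    ∣a^[1+k]∣≡∣b^[1+k]∣ = trans (∣i^n∣≡∣i∣^n a (suc k)) (trans (cong (_^ suc k) α≡β) (sym (∣i^n∣≡∣i∣^n b (suc k))))
    α^[1+k]≤d : α ^ suc k ≤ ∣ a ℤ.^ suc k ℤ.- b ℤ.^ suc k ∣
    α^[1+k]≤d = subst (_≤ ∣ a ℤ.^ suc k ℤ.- b ℤ.^ suc k ∣) (∣i^n∣≡∣i∣^n a (suc k)) (∣i∣≡∣j∣∧i≢j⇒∣i∣≤∣i-j∣ {a ℤ.^ suc k} {b ℤ.^ suc k} ∣a^[1+k]∣≡∣b^[1+k]∣ (1≤∣i-j∣⇒i≢j 1≤d))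

  module Weights {A : Set} (μ τ : A → A → ℕ)
    {{μ≢0 : ∀ {a b} → NonZero (μ a b)}} {{τ≢0 : ∀ {a b} → NonZero (τ a b)}} where

    private variable n : ℕ

    ∏μ : Vec A n → Vec A n → ℕ
    ∏μ []      []      = 1
    ∏μ (a ∷ x) (b ∷ y) = μ a b * ∏μ x y

    τ∏μ : Fin n → Vec A n → Vec A n → ℕ
    τ∏μ zero    (a ∷ x) (b ∷ y) = τ a b * ∏μ x y
    τ∏μ (suc i) (a ∷ x) (b ∷ y) = μ a b * τ∏μ i x y

    ∏F/μ : ℕ → Vec A n → Vec A n → ℕ
    ∏F/μ F []      []      = 1
    ∏F/μ F (a ∷ x) (b ∷ y) = F / μ a b * ∏F/μ F x y

    -- F ^ n * ∑ᵢ 1 / τ∏μ i, computed exactly when every μ and τ divides F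
    weight : ℕ → Vec A n → Vec A n → ℕ
    weight F []      []      = 0
    weight F (a ∷ x) (b ∷ y) = F / τ a b * ∏F/μ F x y + F / μ a b * weight F x y

    Divides : ℕ → Vec A n → Vec A n → Set
    Divides F = Pointwise (λ a b → (μ a b ∣ F) × (τ a b ∣ F))

    ∏F/μ*∏μ≡F^n : ∀ F (x y : Vec A n) → Divides F x y → ∏F/μ F x y * ∏μ x y ≡ F ^ n
    ∏F/μ*∏μ≡F^n F []      []      []                = refl
    ∏F/μ*∏μ≡F^n {suc n} F (a ∷ x) (b ∷ y) ((μ∣F , _) ∷ div) = begin
      F / μ a b * ∏F/μ F x y * (μ a b * ∏μ x y)   ≡⟨ *-interchange (F / μ a b) _ _ _ ⟩
      F / μ a b * μ a b * (∏F/μ F x y * ∏μ x y)   ≡⟨ cong₂ _*_ (m/n*n≡m μ∣F) (∏F/μ*∏μ≡F^n F x y div) ⟩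
      F * F ^ n                                   ∎
      where open ≡-Reasoning

    F^n≤weight*τ∏μ : ∀ F (x y : Vec A n) → Divides F x y → ∀ i → F ^ n ≤ weight F x y * τ∏μ i x y
    F^n≤weight*τ∏μ {suc n} F (a ∷ x) (b ∷ y) ((_ , τ∣F) ∷ div) zero = begin
      F * F ^ n                                    ≡⟨ cong₂ _*_ (m/n*n≡m τ∣F) (∏F/μ*∏μ≡F^n F x y div) ⟨
      F / τ a b * τ a b * (∏F/μ F x y * ∏μ x y)    ≡⟨ *-interchange (F / τ a b) _ _ _ ⟩
      F / τ a b * ∏F/μ F x y * (τ a b * ∏μ x y)    ≤⟨ *-monoˡ-≤ (τ a b * ∏μ x y) (m≤m+n (F / τ a b * ∏F/μ F x y) (F / μ a b * weight F x y)) ⟩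
      weight F (a ∷ x) (b ∷ y) * τ∏μ zero (a ∷ x) (b ∷ y) ∎
      where open ≤-Reasoning
    F^n≤weight*τ∏μ {suc n} F (a ∷ x) (b ∷ y) ((μ∣F , _) ∷ div) (suc i) = begin
      F * F ^ n                                    ≤⟨ *-monoʳ-≤ F (F^n≤weight*τ∏μ F x y div i) ⟩
      F * (weight F x y * τ∏μ i x y)               ≡⟨ cong (_* (weight F x y * τ∏μ i x y)) (m/n*n≡m μ∣F) ⟨
      F / μ a b * μ a b * (weight F x y * τ∏μ i x y) ≡⟨ *-interchange (F / μ a b) _ _ _ ⟩
      F / μ a b * weight F x y * (μ a b * τ∏μ i x y) ≤⟨ *-monoˡ-≤ (μ a b * τ∏μ i x y) (m≤n+m _ (F / τ a b * ∏F/μ F x y)) ⟩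
      weight F (a ∷ x) (b ∷ y) * τ∏μ (suc i) (a ∷ x) (b ∷ y) ∎
      where open ≤-Reasoning

    ∏μ≤M^n : ∀ {M} (x y : Vec A n) → (∀ j → μ (lookup x j) (lookup y j) ≤ M) → ∏μ x y ≤ M ^ n
    ∏μ≤M^n []      []      _  = ≤-refl
    ∏μ≤M^n (a ∷ x) (b ∷ y) ≤M = *-mono-≤ (≤M zero) (∏μ≤M^n x y (≤M ∘ suc))

    τ∏μ≤τ*M^n : ∀ {M} (x y : Vec A (suc n)) → (∀ j → μ (lookup x j) (lookup y j) ≤ M) →
                ∀ i → τ∏μ i x y ≤ τ (lookup x i) (lookup y i) * M ^ n
    τ∏μ≤τ*M^n (a ∷ x) (b ∷ y) ≤M zero = *-monoʳ-≤ (τ a b) (∏μ≤M^n x y (≤M ∘ suc))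
    τ∏μ≤τ*M^n {suc n} {M} (a ∷ x) (b ∷ y) ≤M (suc i) = begin
      μ a b * τ∏μ i x y                            ≤⟨ *-mono-≤ (≤M zero) (τ∏μ≤τ*M^n x y (≤M ∘ suc) i) ⟩
      M * (τᵢ * M ^ n)                             ≡⟨ x∙yz≈y∙xz M τᵢ (M ^ n) ⟩
      τᵢ * (M * M ^ n)                             ∎
      where
      open ≤-Reasoning
      τᵢ = τ (lookup x i) (lookup y i)

  argmax : ∀ {n} (f : Fin (suc n) → ℕ) → ∃ λ i → ∀ j → f j ≤ f i
  argmax {zero}  f = zero , λ { zero → ≤-refl }
  argmax {suc n} f with argmax (f ∘ suc)
  ... | i , ≤fi with ≤-total (f zero) (f (suc i))
  ...   | inj₁ f0≤fi = suc i , λ { zero → f0≤fi ; (suc j) → ≤fi j }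
  ...   | inj₂ fi≤f0 = zero  , λ { zero → ≤-refl ; (suc j) → ≤-trans (≤fi j) fi≤f0 }

  module WeightSums (μ τ : ℤ → ℤ → ℕ)
    {{μ≢0 : ∀ {a b} → NonZero (μ a b)}} {{τ≢0 : ∀ {a b} → NonZero (τ a b)}} (N F : ℕ) where

    open Weights μ τ

    ∑F/τ ∑F/μ : ℕ
    ∑F/τ = ∑² (range N) (λ a b → F / τ a b)
    ∑F/μ = ∑² (range N) (λ a b → F / μ a b)

    ∑²-∏F/μ : ∀ r → ∑² (box N r) (∏F/μ F) ≡ ∑F/μ ^ r
    ∑²-∏F/μ zero    = refl
    ∑²-∏F/μ (suc r) = begin
      ∑² (box N (suc r)) (∏F/μ F)        ≡⟨ ∑²-box-suc N r (∏F/μ F) ⟩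
      ∑² (range N) (λ a b → ∑² (box N r) (λ x y → F / μ a b * ∏F/μ F x y))
                                         ≡⟨ ∑²-product (range N) (box N r) (λ a b → F / μ a b) (∏F/μ F) ⟩
      ∑F/μ * ∑² (box N r) (∏F/μ F)       ≡⟨ cong (∑F/μ *_) (∑²-∏F/μ r) ⟩
      ∑F/μ * ∑F/μ ^ r                    ∎
      where open ≡-Reasoning

    ∑²-weight-suc : ∀ r → ∑² (box N (suc r)) (weight F) ≡ ∑F/τ * ∑F/μ ^ r + ∑F/μ * ∑² (box N r) (weight F)
    ∑²-weight-suc r = begin
      ∑² (box N (suc r)) (weight F)
        ≡⟨ ∑²-box-suc N r (weight F) ⟩
      ∑² (range N) (λ a b → ∑² (box N r) (λ x y → F / τ a b * ∏F/μ F x y + F / μ a b * weight F x y))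
        ≡⟨ ∑²-cong (range N) (λ a b → ∑²-distrib-+ (box N r) _ _) ⟩
      ∑² (range N) (λ a b → ∑² (box N r) (λ x y → F / τ a b * ∏F/μ F x y)
                          + ∑² (box N r) (λ x y → F / μ a b * weight F x y))
        ≡⟨ ∑²-distrib-+ (range N) (λ a b → ∑² (box N r) (λ x y → F / τ a b * ∏F/μ F x y))
                                  (λ a b → ∑² (box N r) (λ x y → F / μ a b * weight F x y)) ⟩
      ∑² (range N) (λ a b → ∑² (box N r) (λ x y → F / τ a b * ∏F/μ F x y))
        + ∑² (range N) (λ a b → ∑² (box N r) (λ x y → F / μ a b * weight F x y))
        ≡⟨ cong₂ _+_ (∑²-product (range N) (box N r) (λ a b → F / τ a b) (∏F/μ F))
                     (∑²-product (range N) (box N r) (λ a b → F / μ a b) (weight F)) ⟩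
      ∑F/τ * ∑² (box N r) (∏F/μ F) + ∑F/μ * ∑² (box N r) (weight F)
        ≡⟨ cong (λ p → ∑F/τ * p + ∑F/μ * ∑² (box N r) (weight F)) (∑²-∏F/μ r) ⟩
      ∑F/τ * ∑F/μ ^ r + ∑F/μ * ∑² (box N r) (weight F)
        ∎
      where open ≡-Reasoning

    ∑²-weight : ∀ r → ∑² (box N (suc r)) (weight F) ≡ suc r * (∑F/τ * ∑F/μ ^ r)
    ∑²-weight zero    = trans (∑²-weight-suc zero) (solve 2 (λ a b → a :* con 1 :+ b :* con 0 := con 1 :* (a :* con 1)) refl ∑F/τ ∑F/μ)
      where open +-*-Solver
    ∑²-weight (suc r) = begin
      ∑² (box N (suc (suc r))) (weight F)              ≡⟨ ∑²-weight-suc (suc r) ⟩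
      ∑F/τ * ∑F/μ ^ suc r + ∑F/μ * ∑² (box N (suc r)) (weight F) ≡⟨ cong (λ w → ∑F/τ * ∑F/μ ^ suc r + ∑F/μ * w) (∑²-weight r) ⟩
      ∑F/τ * ∑F/μ ^ suc r + ∑F/μ * (suc r * (∑F/τ * ∑F/μ ^ r))
        ≡⟨ solve 4 (λ a b p r → a :* (b :* p) :+ b :* ((con 1 :+ r) :* (a :* p)) := (con 2 :+ r) :* (a :* (b :* p))) refl ∑F/τ ∑F/μ (∑F/μ ^ r) r ⟩
      suc (suc r) * (∑F/τ * ∑F/μ ^ suc r)              ∎
      where
      open ≡-Reasoning
      open +-*-Solver

  ∑²-F/gapℤ≤ : ∀ N F → 2 ≤ N → ∑² (range N) (λ a b → F / gapℤ a b) ≤ 56 * (N * (F * ⌊log₂ N ⌋))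
  ∑²-F/gapℤ≤ N@(suc N-1) F 2≤N = begin
    ∑² (range N) (λ a b → F / gapℤ a b)       ≤⟨ ∑²-range≤ N (λ α β → F / gap α β) ⟩
    2 * (2 * (∑[ α < suc N ] ∑[ β < suc N ] F / gap α β)) ≤⟨ *-monoʳ-≤ 2 (*-monoʳ-≤ 2 (∑<²-F/gap≤ F (suc N))) ⟩
    2 * (2 * (suc N * (2 * H + F)))           ≤⟨ *-monoʳ-≤ 2 (*-monoʳ-≤ 2 (*-mono-≤ (1+n≤2*n {N} (s≤s z≤n)) (+-mono-≤ (*-monoʳ-≤ 2 H≤3FL) F≤FL))) ⟩
    2 * (2 * (2 * N * (2 * (F * (3 * L)) + F * L)))
      ≡⟨ solve 3 (λ N F L → con 2 :* (con 2 :* (con 2 :* N :* (con 2 :* (F :* (con 3 :* L)) :+ F :* L)))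
                            := con 56 :* (N :* (F :* L))) refl N F L ⟩
    56 * (N * (F * L))                        ∎
    where
    open ≤-Reasoning
    open +-*-Solver
    L = ⌊log₂ N ⌋
    H = ∑[ s < suc N ] F / suc s
    1≤L : 1 ≤ L
    1≤L = 2≤n⇒1≤⌊log₂n⌋ 2≤N
    F≤FL : F ≤ F * L
    F≤FL = ≤-trans (≤-reflexive (sym (*-identityʳ F))) (*-monoʳ-≤ F 1≤L)
    H≤3FL : H ≤ F * (3 * L)
    H≤3FL = begin
      H                           ≤⟨ harmonic≤ F (suc N) ⟩
      F * suc ⌊log₂ (suc N) ⌋     ≤⟨ *-monoʳ-≤ F (s≤s (⌊log₂[2+n]⌋≤1+⌊log₂[1+n]⌋ N-1)) ⟩
      F * (2 + L)                 ≤⟨ *-monoʳ-≤ F (+-monoˡ-≤ L (*-monoʳ-≤ 2 1≤L)) ⟩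
      F * (2 * L + L)             ≡⟨ cong (F *_) (+-comm (2 * L) L) ⟩
      F * (3 * L)                 ∎

  ∑²-F/heightℤ≤ : ∀ N F → 1 ≤ N → ∑² (range N) (λ a b → F / heightℤ a b) ≤ 24 * (N * F)
  ∑²-F/heightℤ≤ N F 1≤N = begin
    ∑² (range N) (λ a b → F / heightℤ a b)     ≤⟨ ∑²-range≤ N (λ α β → F / height α β) ⟩
    2 * (2 * (∑[ α < suc N ] ∑[ β < suc N ] F / height α β)) ≤⟨ *-monoʳ-≤ 2 (*-monoʳ-≤ 2 (∑<²-F/height≤ F (suc N))) ⟩
    2 * (2 * (suc N * (3 * F)))                ≤⟨ *-monoʳ-≤ 2 (*-monoʳ-≤ 2 (*-monoˡ-≤ (3 * F) (1+n≤2*n 1≤N))) ⟩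
    2 * (2 * (2 * N * (3 * F)))                ≡⟨ solve 2 (λ N F → con 2 :* (con 2 :* (con 2 :* N :* (con 3 :* F))) := con 24 :* (N :* F)) refl N F ⟩
    24 * (N * F)                               ∎
    where
    open ≤-Reasoning
    open +-*-Solver

  [m*n]^k≡m^k*n^k : ∀ m n k → (m * n) ^ k ≡ m ^ k * n ^ k
  [m*n]^k≡m^k*n^k m n zero    = refl
  [m*n]^k≡m^k*n^k m n (suc k) =
    trans (cong (m * n *_) ([m*n]^k≡m^k*n^k m n k)) (*-interchange m n (m ^ k) (n ^ k))

  m∣n! : ∀ {m n} .{{_ : NonZero m}} → m ≤ n → m ∣ n !
  m∣n! {suc m} m≤n = ∣-trans (m∣m*n (m !)) (m≤n⇒m!∣n! m≤n)

  n!^m≢0 : ∀ n m → NonZero ((n !) ^ m)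
  n!^m≢0 n m = m^n≢0 (n !) m {{n !≢0}}

  /≤/ : ∀ {a b} D E .{{_ : NonZero D}} .{{_ : NonZero E}} →
        a * E ≤ b * D → ℤ.+ a ℚᵘ./ D ℚᵘ.≤ ℤ.+ b ℚᵘ./ E
  /≤/ {a} {b} (suc D) (suc E) le = ℚᵘ.*≤* (subst₂ ℤ._≤_ (ℤ.pos-* a (suc E)) (ℤ.pos-* b (suc D)) (ℤ.+≤+ le))

  recip≤/ : ∀ {d w} D .{{_ : NonZero D}} → 1 ≤ d → D ≤ w * d → toℚᵘ (recip d) ℚᵘ.≤ ℤ.+ w ℚᵘ./ D
  recip≤/ {suc d} D _ D≤wd = ℚᵘ.≤-respˡ-≃ (ℚᵘ.≃-sym (ℚ.toℚᵘ-fromℚᵘ (ℤ.+ 1 ℚᵘ./ suc d)))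
    (/≤/ (suc d) D (subst (_≤ _) (sym (*-identityˡ D)) D≤wd))

  /+/≤/ : ∀ a b D .{{_ : NonZero D}} → ℤ.+ a ℚᵘ./ D ℚᵘ.+ ℤ.+ b ℚᵘ./ D ℚᵘ.≤ ℤ.+ (a + b) ℚᵘ./ D
  /+/≤/ a b (suc D) = ℚᵘ.*≤* (ℤ.≤-reflexive (begin
    (ℤ.+ a ℤ.* ℤ.+ suc D ℤ.+ ℤ.+ b ℤ.* ℤ.+ suc D) ℤ.* ℤ.+ suc D
      ≡⟨ cong (ℤ._* ℤ.+ suc D) (cong₂ ℤ._+_ (ℤ.pos-* a (suc D)) (ℤ.pos-* b (suc D))) ⟨
    (ℤ.+ (a * suc D) ℤ.+ ℤ.+ (b * suc D)) ℤ.* ℤ.+ suc D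
      ≡⟨ cong (ℤ._* ℤ.+ suc D) (ℤ.pos-+ (a * suc D) (b * suc D)) ⟨
    ℤ.+ (a * suc D + b * suc D) ℤ.* ℤ.+ suc D
      ≡⟨ ℤ.pos-* (a * suc D + b * suc D) (suc D) ⟨
    ℤ.+ ((a * suc D + b * suc D) * suc D)
      ≡⟨ cong ℤ.+_ (solve 3 (λ a b D → (a :* D :+ b :* D) :* D := (a :+ b) :* (D :* D)) refl a b (suc D)) ⟩
    ℤ.+ ((a + b) * (suc D * suc D))
      ≡⟨ ℤ.pos-* (a + b) (suc D * suc D) ⟩
    ℤ.+ (a + b) ℤ.* ℤ.+ (suc D * suc D)
      ∎))
    where
    open ≡-Reasoning
    open +-*-Solver

  /-monoˡ-≤ᵘ : ∀ {a b} D .{{_ : NonZero D}} → a ≤ b → ℤ.+ a ℚᵘ./ D ℚᵘ.≤ ℤ.+ b ℚᵘ./ D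
  /-monoˡ-≤ᵘ D a≤b = /≤/ D D (*-monoˡ-≤ D a≤b)

  ∑-filterᵇ≤ : ∀ (p : A → Bool) (t : A → ℚ) (w : A → ℕ) D .{{_ : NonZero D}} (xs : List A) →
    All (λ e → T (p e) → toℚᵘ (t e) ℚᵘ.≤ ℤ.+ w e ℚᵘ./ D) xs →
    toℚᵘ (foldr (λ e acc → t e ℚ.+ acc) 0ℚ (filterᵇ p xs)) ℚᵘ.≤ ℤ.+ ∑∈ xs w ℚᵘ./ D
  ∑-filterᵇ≤ p t w (suc D) []       []       = ℚᵘ.*≤* (ℤ.+≤+ z≤n)
  ∑-filterᵇ≤ p t w D       (e ∷ xs) (h ∷ hs) with p e
  ... | true  = ℚᵘ.≤-respˡ-≃ (ℚᵘ.≃-sym (ℚ.toℚᵘ-homo-+ (t e) _))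
                  (ℚᵘ.≤-trans (ℚᵘ.+-mono-≤ (h _) (∑-filterᵇ≤ p t w D xs hs)) (/+/≤/ (w e) (∑∈ xs w) D))
  ... | false = ℚᵘ.≤-trans (∑-filterᵇ≤ p t w D xs hs) (/-monoˡ-≤ᵘ D (m≤n+m (∑∈ xs w) (w e)))

  chainOK⇒bounded : ∀ d ds → T (chainOK (d ∷ ds)) → All (λ e → 1 ≤ e × e ≤ d) (d ∷ ds)
  chainOK⇒bounded d []       ok = (≤ᵇ⇒≤ 1 d ok , ≤-refl) ∷ []
  chainOK⇒bounded d (e ∷ es) ok with Equivalence.to T-∧ ok
  ... | e≤ᵇd , ok′ = (≤-trans 1≤e e≤d , ≤-refl) ∷ All.map (map₂ (λ f≤e → ≤-trans f≤e e≤d)) bounded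
    where
    e≤d     = ≤ᵇ⇒≤ e d e≤ᵇd
    bounded = chainOK⇒bounded e es ok′
    1≤e     = proj₁ (All.head bounded)

  All-toList-zipWith : ∀ {n} {P : C → Set} (f : A → B → C) (x : Vec A n) (y : Vec B n) →
    All P (toList (zipWith f x y)) → ∀ j → P (f (lookup x j) (lookup y j))
  All-toList-zipWith f (a ∷ x) (b ∷ y) (p ∷ ps) zero    = p
  All-toList-zipWith f (a ∷ x) (b ∷ y) (p ∷ ps) (suc j) = All-toList-zipWith f x y ps j

  open Weights heightℤ gapℤ

  bounded⇒divides : ∀ {N n} {x y : Vec ℤ n} → 1 ≤ N → Bounded N x → Bounded N y → Divides (N !) x y
  bounded⇒divides 1≤N [] [] = []
  bounded⇒divides 1≤N (_∷_ {a} ∣a∣≤N bx) (_∷_ {b} ∣b∣≤N by) =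
    (m∣n! (max1≤ 1≤N α⊔β≤N) , m∣n! (max1≤ 1≤N (≤-trans (∣m-n∣≤m⊔n ∣ a ∣ ∣ b ∣) α⊔β≤N))) ∷ bounded⇒divides 1≤N bx by
    where α⊔β≤N = ⊔-lub ∣a∣≤N ∣b∣≤N

  recip[d₁]≤weight/F^r : ∀ {k r} N (x y : Vec ℤ (suc r)) → r ≤ k → 1 ≤ N →
    Bounded N x → Bounded N y → T (chainOK (diffs (suc k) x y)) →
    toℚᵘ (recip (firstDiff (diffs (suc k) x y))) ℚᵘ.≤ (ℤ.+ weight (N !) x y ℚᵘ./ ((N !) ^ suc r)) {{n!^m≢0 N (suc r)}}
  recip[d₁]≤weight/F^r {k} {r} N x@(a ∷ _) y@(b ∷ _) r≤k 1≤N bx by ok =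
    recip≤/ ((N !) ^ suc r) {{n!^m≢0 N (suc r)}} (proj₁ (All.head bounds)) (begin
      (N !) ^ suc r        ≤⟨ F^n≤weight*τ∏μ (N !) x y (bounded⇒divides 1≤N bx by) i ⟩
      W * τ∏μ i x y        ≤⟨ *-monoʳ-≤ W (τ∏μ≤τ*M^n x y μⱼ≤μᵢ i) ⟩
      W * (τᵢ * μᵢ ^ r)    ≤⟨ *-monoʳ-≤ W (*-monoʳ-≤ τᵢ (^-monoʳ-≤ μᵢ r≤k)) ⟩
      W * (τᵢ * μᵢ ^ k)    ≤⟨ *-monoʳ-≤ W (gap*height^k≤∣a^[1+k]-b^[1+k]∣ k (lookup x i) (lookup y i) 1≤dᵢ) ⟩
      W * dᵢ               ≤⟨ *-monoʳ-≤ W dᵢ≤d₁ ⟩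
      W * d₁               ∎)
    where
    open ≤-Reasoning
    W = weight (N !) x y
    d : ℤ → ℤ → ℕ
    d a b = ∣ a ℤ.^ suc k ℤ.- b ℤ.^ suc k ∣
    d₁ = d a b
    bounds : All (λ e → 1 ≤ e × e ≤ d₁) (diffs (suc k) x y)
    bounds = chainOK⇒bounded d₁ _ ok
    maximal = argmax (λ j → heightℤ (lookup x j) (lookup y j))
    i = proj₁ maximal
    μⱼ≤μᵢ = proj₂ maximal
    μᵢ = heightℤ (lookup x i) (lookup y i)
    τᵢ = gapℤ (lookup x i) (lookup y i)
    dᵢ = d (lookup x i) (lookup y i)
    1≤dᵢ : 1 ≤ dᵢ
    1≤dᵢ = proj₁ (All-toList-zipWith d x y bounds i)
    dᵢ≤d₁ : dᵢ ≤ d₁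
    dᵢ≤d₁ = proj₂ (All-toList-zipWith d x y bounds i)

  sumS≤∑²weight/F^r : ∀ {k r} N → r ≤ k → 1 ≤ N →
    toℚᵘ (sumS (suc k) (suc r) N) ℚᵘ.≤ (ℤ.+ ∑² (box N (suc r)) (weight (N !)) ℚᵘ./ ((N !) ^ suc r)) {{n!^m≢0 N (suc r)}}
  sumS≤∑²weight/F^r {k} {r} N r≤k 1≤N = ℚᵘ.≤-trans
    (∑-filterᵇ≤ _ _ (λ e → weight (N !) (proj₁ e) (proj₂ e)) ((N !) ^ suc r) {{n!^m≢0 N (suc r)}} _
      (All.map (λ { (bx , by) → recip[d₁]≤weight/F^r N _ _ r≤k 1≤N bx by }) (pairs-bounded N (suc r))))
    (/-monoˡ-≤ᵘ ((N !) ^ suc r) {{n!^m≢0 N (suc r)}} (≤-reflexive (∑∈-pairs (box N (suc r)) (weight (N !)))))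

  ∑²weight≤ : ∀ N r → 2 ≤ N →
    ∑² (box N (suc r)) (weight (N !)) * 1 ≤ suc r * 56 * 24 ^ r * N ^ suc r * ⌊log₂ N ⌋ * (N !) ^ suc r
  ∑²weight≤ N r 2≤N = begin
    ∑² (box N (suc r)) (weight F) * 1
      ≡⟨ *-identityʳ _ ⟩
    ∑² (box N (suc r)) (weight F)
      ≡⟨ ∑²-weight r ⟩
    suc r * (∑F/τ * ∑F/μ ^ r)
      ≤⟨ *-monoʳ-≤ (suc r) (*-mono-≤ (∑²-F/gapℤ≤ N F 2≤N) (^-monoˡ-≤ r (∑²-F/heightℤ≤ N F 1≤N))) ⟩
    suc r * (56 * (N * (F * L)) * (24 * (N * F)) ^ r)
      ≡⟨ cong (λ p → suc r * (56 * (N * (F * L)) * p))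
              (trans ([m*n]^k≡m^k*n^k 24 (N * F) r) (cong (24 ^ r *_) ([m*n]^k≡m^k*n^k N F r))) ⟩
    suc r * (56 * (N * (F * L)) * (24 ^ r * (N ^ r * F ^ r)))
      ≡⟨ solve 7 (λ s N F L c n f → s :* (con 56 :* (N :* (F :* L)) :* (c :* (n :* f)))
                                    := s :* con 56 :* c :* (N :* n) :* L :* (F :* f))
               refl (suc r) N F L (24 ^ r) (N ^ r) (F ^ r) ⟩
    suc r * 56 * 24 ^ r * N ^ suc r * L * F ^ suc r
      ∎
    where
    open ≤-Reasoning
    open +-*-Solver
    F = N !
    L = ⌊log₂ N ⌋
    1≤N = ≤-trans (s≤s z≤n) 2≤N
    open WeightSums heightℤ gapℤ N F

  sumS≤ : ∀ {k r} N → r ≤ k → 2 ≤ N →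
    sumS (suc k) (suc r) N ℚ.≤ ℤ.+ (suc r * 56 * 24 ^ r * N ^ suc r * ⌊log₂ N ⌋) ℚ./ 1
  sumS≤ {r = r} N r≤k 2≤N = ℚ.toℚᵘ-cancel-≤ (ℚᵘ.≤-respʳ-≃ (ℚᵘ.≃-sym (ℚ.toℚᵘ-fromℚᵘ _))
    (ℚᵘ.≤-trans (sumS≤∑²weight/F^r N r≤k (≤-trans (s≤s z≤n) 2≤N))
                (/≤/ {b = X} ((N !) ^ suc r) 1 {{n!^m≢0 N (suc r)}} (∑²weight≤ N r 2≤N))))
    where X = suc r * 56 * 24 ^ r * N ^ suc r * ⌊log₂ N ⌋

open import Defs
open import Data.Nat using (ℕ; _≤_; _*_; _^_; suc; s≤s)
open import Data.Nat.Logarithm using (⌊log₂_⌋)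
open import Data.Integer using (+_)
open import Data.Rational using (_/_) renaming (_≤_ to _≤ℚ_)
open import Data.Product using (∃; _,_)

lemma3 : (k r : ℕ) → 2 ≤ k → 1 ≤ r → r ≤ k →
    ∃ λ (C : ℕ) → (N : ℕ) → 2 ≤ N →
      sumS k r N ≤ℚ ((+ (C * (N ^ r) * ⌊log₂ N ⌋)) / 1)
lemma3 (suc k) (suc r) _ _ (s≤s r≤k) = suc r * 56 * 24 ^ r , λ N 2≤N → sumS≤ N r≤k 2≤N
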